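{- Let $S$ be a flat clusteron or a flat near-clusteron with $N$ violinists, and suppose the occupancy word of $S$ is not one of $11011$, $1011$, $1101$, $101$. Then for every shadow $F\in\mathcal{F}_N$ there is a final state reachable from $S$ whose shadow is $F$.
   Context: Rooms are indexed by the integers, room $i$ adjacent to rooms $i\pm1$. A state is a finite placement of indistinguishable violinists in rooms. A move is possible whenever two adjacent rooms $i,i+1$ are both occupied: one violinist leaves room $i$ for the nearest unoccupied room to the left of $i$, and one violinist leaves room $i+1$ for the nearest unoccupied room to the right of $i+1$. A state is final if no move is possible; reachable means obtained by a finite (possibly empty) sequence of moves. A flat clusteron is a state in which a set of consecutive rooms each contain exactly one violinist and all other rooms are empty (occupancy word $11\cdots1$). A flat near-clusteron is a state with at most one violinist per room whose occupancy word, from leftmost to rightmost occupied room, contains exactly one $0$ (e.g. $11101$); its size is the number of violinists. For a state with at most one violinist per room, its shadow is its $0/1$ occupancy word from leftmost to rightmost occupied room. For $N\ge2$ and $1\le k\le N-1$, $F_{N,k}$ is the shadow with $N$ ones in which consecutive ones are separated by a single $0$, except the $k$-th and $(k+1)$-st ones, separated by $00$; $\mathcal{F}_N=\{F_{N,k}:1\le k\le N-1\}$ (empty for $N=1$). -}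

module Defs where

open import Data.Nat using (ℕ; zero; suc; _∸_; _≤_; _<_)
open import Data.Integer as ℤ using (ℤ; +_; _-_)
open import Data.Bool using (Bool; true; false; if_then_else_; _∨_)
open import Data.List using (List; []; _∷_; _++_; replicate; length; lookup; last)
open import Data.Maybe using (Maybe; just; nothing)
open import Data.Product using (Σ; ∃; _×_; _,_)
open import Data.Sum using (_⊎_)
open import Data.Fin using (Fin; fromℕ<)
open import Relation.Nullary using (¬_; does)
open import Relation.Nullary.Decidable using (yes; no)
open import Relation.Binary.PropositionalEquality using (_≡_)
open import Relation.Binary.Construct.Closure.ReflexiveTransitive using (Star)

-- A state: number of violinists in each room (rooms indexed by ℤ).
State : Set
State = ℤ → ℕ

Occupied : State → ℤ → Set
Occupied s x = 1 ≤ s x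

NearestEmptyLeft : State → ℤ → ℤ → Set
NearestEmptyLeft s i a = (a ℤ.< i) × (s a ≡ 0) × (∀ j → a ℤ.< j → j ℤ.< i → Occupied s j)

NearestEmptyRight : State → ℤ → ℤ → Set
NearestEmptyRight s r b = (r ℤ.< b) × (s b ≡ 0) × (∀ j → r ℤ.< j → j ℤ.< b → Occupied s j)

_==_ : ℤ → ℤ → Bool
x == y = does (x ℤ.≟ y)

moveResult : State → ℤ → ℤ → ℤ → State
moveResult s i a b x =
  if (x == i) ∨ (x == (i ℤ.+ + 1)) then s x ∸ 1
  else if (x == a) ∨ (x == b) then 1
  else s x

Step : State → State → Set
Step s t = ∃ λ (i : ℤ) → ∃ λ (a : ℤ) → ∃ λ (b : ℤ) →
  Occupied s i × Occupied s (i ℤ.+ + 1) ×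
  NearestEmptyLeft s i a × NearestEmptyRight s (i ℤ.+ + 1) b ×
  (∀ x → t x ≡ moveResult s i a b x)

Reachable : State → State → Set
Reachable = Star Step

Final : State → Set
Final s = ¬ (∃ λ (i : ℤ) → Occupied s i × Occupied s (i ℤ.+ + 1))

Word : Set
Word = List Bool

b2n : Bool → ℕ
b2n true = 1
b2n false = 0

wordAtℕ : Word → ℕ → ℕ
wordAtℕ [] n = 0
wordAtℕ (c ∷ w) zero = b2n c
wordAtℕ (c ∷ w) (suc n) = wordAtℕ w n

wordAt : Word → ℤ → ℕ
wordAt w (+ n) = wordAtℕ w n
wordAt w ℤ.-[1+ n ] = 0

ProperWord : Word → Set
ProperWord [] = Data.Unit.⊤
  where import Data.Unit
ProperWord (c ∷ w) = (c ≡ true) × (last (c ∷ w) ≡ just true)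

-- s has at most one violinist per room and its occupancy word from
-- leftmost to rightmost occupied room is w
HasShadow : State → Word → Set
HasShadow s w = ProperWord w × (∃ λ (m : ℤ) → ∀ x → s x ≡ wordAt w (x - m))

FlatClusteronWord : ℕ → Word → Set
FlatClusteronWord N w = (1 ≤ N) × (w ≡ replicate N true)

FlatNearClusteronWord : ℕ → Word → Set
FlatNearClusteronWord N w = ∃ λ p → ∃ λ q →
  (1 ≤ p) × (1 ≤ q) × (p Data.Nat.+ q ≡ N) × (w ≡ replicate p true ++ false ∷ replicate q true)

-- F_{N,k}: N ones, consecutive ones separated by 0, except the k-th and
-- (k+1)-st separated by 00.  gapsFrom j N k builds the part after the j-th one.
gapsFrom : ℕ → ℕ → ℕ → Word
gapsFrom j zero k = []
gapsFrom j (suc r) k =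
  (if does (j Data.Nat.≟ k) then false ∷ false ∷ [] else false ∷ [])
  ++ true ∷ gapsFrom (suc j) r k

-- F N k (meaningful for 1 ≤ k ≤ N-1): first 1, then N-1 more ones
F : ℕ → ℕ → Word
F zero k = []
F (suc n) k = true ∷ gapsFrom 1 n k

Excluded : Word → Set
Excluded w =
  (w ≡ true ∷ true ∷ false ∷ true ∷ true ∷ []) ⊎
  (w ≡ true ∷ false ∷ true ∷ true ∷ []) ⊎
  (w ≡ true ∷ true ∷ false ∷ true ∷ []) ⊎
  (w ≡ true ∷ false ∷ true ∷ [])

-- All states involved have at most one violinist per room, so each is its shadow placed
-- somewhere on ℤ. On such states a move is the word rewrite 0 1ᵖ 11 1^q 0 ↦ 1 1ᵖ 00 1^q 1,
-- and moves commute with translation and ignore padding by empty rooms; so it suffices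
-- to rewrite the padded shadow of S into F_{N,k} = (10)^(k-1) 100 (10)^(N-k-1) 1, which
-- has no two adjacent ones and hence is final. The core rewrite: a cluster 1^(b+1) with
-- b empty rooms to its left unwinds into 100 (10)^b; then the violinists of a cluster
-- 1^m 1 0^m further right are shed one at a time, each time a pair 11 bubbles left
-- through the (10)-blocks and the double gap moves two rooms to the right. A clusteron,
-- and a near-clusteron 1^p 0 1^q with k ≠ q, reach the input of this rewrite in one
-- move; for k = q two or three preparatory moves are needed, which requires p ≥ 3 or
-- q ≥ 3, i.e. that the word is not excluded.

module Submission where

open import Defs
open import Data.Nat using (ℕ; _≤_; _<_)
open import Data.Product using (∃; _×_)
open import Data.Sum using (_⊎_)
open import Relation.Nullary using (¬_)

open import Data.Nat as ℕ using (zero; suc; _+_; _∸_; _≡ᵇ_; z≤n; s≤s)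
import Data.Nat.Properties as ℕP
import Data.Nat.Tactic.RingSolver as ℕ-Solver
open import Data.Integer as ℤ using (ℤ; +_; -[1+_])
import Data.Integer.Properties as ℤP
import Data.Integer.Tactic.RingSolver as ℤ-Solver
open import Data.Bool using (Bool; true; false; if_then_else_; _∨_)
open import Data.List using (List; []; _∷_; _++_; replicate; length; last)
open import Data.List.Properties using (++-assoc; ++-identityʳ)
open import Data.Maybe using (just)
open import Data.Product using (∃₂; _,_; proj₁; proj₂)
open import Data.Sum using (inj₁; inj₂)
open import Data.Empty using (⊥; ⊥-elim)
open import Function.Base using (_∘_)
open import Function.Bundles using (mk⇔)
open import Relation.Binary.PropositionalEquality
open import Relation.Binary.Definitions using (tri<; tri≈; tri>)
open import Relation.Binary.Construct.Closure.ReflexiveTransitive using (Star; ε; _◅_; _◅◅_; gmap)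
open import Relation.Binary.Construct.Closure.ReflexiveTransitive.Properties using (module StarReasoning)
open import Relation.Nullary.Decidable using (dec-true; dec-false; does-⇔)

ones zeros : ℕ → Word
ones n = replicate n true
zeros n = replicate n false

replicate-∷ : ∀ {A : Set} n (x : A) xs → replicate n x ++ x ∷ xs ≡ x ∷ replicate n x ++ xs
replicate-∷ zero    x xs = refl
replicate-∷ (suc n) x xs = cong (x ∷_) (replicate-∷ n x xs)

replicate-+ : ∀ {A : Set} m n (x : A) xs →
              replicate (m + n) x ++ xs ≡ replicate m x ++ replicate n x ++ xs
replicate-+ zero    n x xs = refl
replicate-+ (suc m) n x xs = cong (x ∷_) (replicate-+ m n x xs)

ones-run : ∀ p q X → ones p ++ true ∷ true ∷ ones q ++ X ≡ ones (p + suc (suc q)) ++ X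
ones-run p q X = sym (replicate-+ p (suc (suc q)) true X)

ones-++-11 : ∀ n X → ones n ++ true ∷ true ∷ X ≡ ones (suc (suc n)) ++ X
ones-++-11 n X = trans (replicate-∷ n true _) (cong (true ∷_) (replicate-∷ n true X))

ones-split : ∀ l r X → ones (suc (suc r) + l) ++ X ≡ ones l ++ true ∷ true ∷ ones r ++ X
ones-split l r X = trans (cong (λ n → ones n ++ X) (ℕP.+-comm (suc (suc r)) l)) (sym (ones-run l r X))

ones-merge : ∀ l r X → ones l ++ true ∷ ones r ++ X ≡ ones (suc (l + r)) ++ X
ones-merge l r X = trans (replicate-∷ l true _) (cong (true ∷_) (sym (replicate-+ l r true X)))

last-∷ʳ : ∀ {A : Set} (xs : List A) x → last (xs ++ x ∷ []) ≡ just x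
last-∷ʳ []           x = refl
last-∷ʳ (_ ∷ [])     x = refl
last-∷ʳ (_ ∷ y ∷ ys) x = last-∷ʳ (y ∷ ys) x

-- spaced a X is (10)ᵃ X.
spaced : ℕ → Word → Word
spaced zero    X = X
spaced (suc a) X = spaced a (true ∷ false ∷ X)

spaced-∷ : ∀ a X → spaced a (true ∷ false ∷ X) ≡ true ∷ false ∷ spaced a X
spaced-∷ zero    X = refl
spaced-∷ (suc a) X = spaced-∷ a (true ∷ false ∷ X)

spaced-++ : ∀ a X Y → spaced a X ++ Y ≡ spaced a (X ++ Y)
spaced-++ zero    X Y = refl
spaced-++ (suc a) X Y = spaced-++ a (true ∷ false ∷ X) Y

spaced-head : ∀ a X → ∃ λ Y → spaced a (true ∷ X) ≡ true ∷ Y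
spaced-head zero    X = X , refl
spaced-head (suc a) X = false ∷ spaced a (true ∷ X) , spaced-∷ a (true ∷ X)

doubleGap : ℕ → ℕ → Word
doubleGap a b = spaced a (true ∷ false ∷ false ∷ spaced b (true ∷ []))

doubleGap-proper : ∀ a b → ProperWord (doubleGap a b)
doubleGap-proper a b with spaced-head a (false ∷ false ∷ spaced b (true ∷ []))
... | Y , head rewrite head = refl , subst (λ w → last w ≡ just true) head ends-with-one
  where
  ends-with-one : last (doubleGap a b) ≡ just true
  ends-with-one = begin
    last (spaced a (true ∷ false ∷ false ∷ spaced b (true ∷ [])))
      ≡⟨ cong (λ w → last (spaced a (true ∷ false ∷ false ∷ w))) (sym (spaced-++ b [] _)) ⟩
    last (spaced a (true ∷ false ∷ false ∷ spaced b [] ++ true ∷ []))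
      ≡⟨ cong last (sym (spaced-++ a _ _)) ⟩
    last (spaced a (true ∷ false ∷ false ∷ spaced b []) ++ true ∷ [])
      ≡⟨ last-∷ʳ (spaced a (true ∷ false ∷ false ∷ spaced b [])) true ⟩
    just true ∎
    where open ≡-Reasoning

noAdjacentOnes : Word → Bool
noAdjacentOnes []                 = true
noAdjacentOnes (false ∷ w)        = noAdjacentOnes w
noAdjacentOnes (true ∷ [])        = true
noAdjacentOnes (true ∷ false ∷ w) = noAdjacentOnes w
noAdjacentOnes (true ∷ true ∷ w)  = false

noAdjacentOnes-spaced : ∀ a X → noAdjacentOnes (spaced a X) ≡ noAdjacentOnes X
noAdjacentOnes-spaced zero    X = refl
noAdjacentOnes-spaced (suc a) X = noAdjacentOnes-spaced a (true ∷ false ∷ X)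

doubleGap-noAdjacentOnes : ∀ a b → noAdjacentOnes (doubleGap a b) ≡ true
doubleGap-noAdjacentOnes a b = trans (noAdjacentOnes-spaced a _) (noAdjacentOnes-spaced b (true ∷ []))

gapsFrom-spaced : ∀ {j k} b → k < j → true ∷ gapsFrom j b k ≡ spaced b (true ∷ [])
gapsFrom-spaced zero _ = refl
gapsFrom-spaced {j} {k} (suc b) k<j rewrite dec-false (j ℕ.≟ k) (ℕP.>⇒≢ k<j) =
  trans (cong (λ w → true ∷ false ∷ w) (gapsFrom-spaced b (ℕP.m<n⇒m<1+n k<j)))
        (sym (spaced-∷ b _))

gapsFrom-doubleGap : ∀ a j b → true ∷ gapsFrom j (a + suc b) (a + j) ≡ doubleGap a b
gapsFrom-doubleGap zero j b rewrite dec-true (j ℕ.≟ j) refl =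
  cong (λ w → true ∷ false ∷ false ∷ w) (gapsFrom-spaced b (ℕP.n<1+n j))
gapsFrom-doubleGap (suc a) j b
  rewrite dec-false (j ℕ.≟ suc (a + j)) (ℕP.<⇒≢ (s≤s (ℕP.m≤n+m j a))) = begin
    true ∷ false ∷ true ∷ gapsFrom (suc j) (a + suc b) (suc (a + j))
      ≡⟨ cong (λ k → true ∷ false ∷ true ∷ gapsFrom (suc j) (a + suc b) k) (sym (ℕP.+-suc a j)) ⟩
    true ∷ false ∷ true ∷ gapsFrom (suc j) (a + suc b) (a + suc j)
      ≡⟨ cong (λ w → true ∷ false ∷ w) (gapsFrom-doubleGap a (suc j) b) ⟩
    true ∷ false ∷ doubleGap a b
      ≡⟨ sym (spaced-∷ a _) ⟩
    doubleGap (suc a) b ∎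
  where open ≡-Reasoning

F≡doubleGap : ∀ {N k} a b → N ≡ suc (a + suc b) → k ≡ suc a → F N k ≡ doubleGap a b
F≡doubleGap a b refl refl =
  trans (cong (λ k → true ∷ gapsFrom 1 (a + suc b) k) (ℕP.+-comm 1 a)) (gapsFrom-doubleGap a 1 b)

doubleGap≡F : ∀ {N k} a b → N ≡ suc (a + suc b) → k ≡ suc a → doubleGap a b ≡ F N k ++ []
doubleGap≡F a b N≡ k≡ = trans (sym (F≡doubleGap a b N≡ k≡)) (sym (++-identityʳ _))

F-shape : ∀ {N k} → 1 ≤ k → k < N → ∃₂ λ a b → F N k ≡ doubleGap a b
F-shape {k = suc a} _ k<N with b , refl ← ℕP.m≤n⇒∃[o]m+o≡n k<N =
  a , b , F≡doubleGap a b (cong suc (sym (ℕP.+-suc a b))) refl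

-- A move at the pair 11 inside the maximal run 1ᵖ 11 1^q: its two violinists land in
-- the empty rooms bounding the run.
preMove postMove : Word → ℕ → ℕ → Word → Word
preMove  A p q B = A ++ false ∷ ones p ++ true ∷ true ∷ ones q ++ false ∷ B
postMove A p q B = A ++ true ∷ ones p ++ false ∷ false ∷ ones q ++ true ∷ B

infix 4 _⟶_ _⟶*_

data _⟶_ : Word → Word → Set where
  move : ∀ A p q B → preMove A p q B ⟶ postMove A p q B

_⟶*_ : Word → Word → Set
_⟶*_ = Star _⟶_

wordAtℕ-++ : ∀ A X n → wordAtℕ (A ++ X) (length A + n) ≡ wordAtℕ X n
wordAtℕ-++ []      X n = refl
wordAtℕ-++ (_ ∷ A) X n = wordAtℕ-++ A X n

wordAtℕ-at-length : ∀ A x X → wordAtℕ (A ++ x ∷ X) (length A) ≡ b2n x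
wordAtℕ-at-length []      x X = refl
wordAtℕ-at-length (_ ∷ A) x X = wordAtℕ-at-length A x X

wordAtℕ-replicate : ∀ k x X → wordAtℕ (replicate k x ++ X) k ≡ wordAtℕ X 0
wordAtℕ-replicate zero    x X = refl
wordAtℕ-replicate (suc k) x X = wordAtℕ-replicate k x X

wordAtℕ-ones : ∀ k X {n} → n < k → wordAtℕ (ones k ++ X) n ≡ 1
wordAtℕ-ones (suc k) X {zero}  _         = refl
wordAtℕ-ones (suc k) X {suc n} (s≤s n<k) = wordAtℕ-ones k X n<k

preMove-run : ∀ A p q B {n} → length A < n → n < length A + suc (p + suc (suc q)) →
              wordAtℕ (preMove A p q B) n ≡ 1
preMove-run []      p q B {suc n} _ (s≤s n<b) =
  trans (cong (λ w → wordAtℕ w n) (ones-run p q _)) (wordAtℕ-ones _ _ n<b)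
preMove-run (_ ∷ A) p q B {suc n} (s≤s a<n) (s≤s n<b) = preMove-run A p q B a<n n<b

preMove-right-end : ∀ A p q B → wordAtℕ (preMove A p q B) (length A + suc (p + suc (suc q))) ≡ 0
preMove-right-end A p q B = begin
  wordAtℕ (preMove A p q B) (length A + suc (p + suc (suc q)))
    ≡⟨ wordAtℕ-++ A _ _ ⟩
  wordAtℕ (ones p ++ true ∷ true ∷ ones q ++ false ∷ B) (p + suc (suc q))
    ≡⟨ cong (λ w → wordAtℕ w (p + suc (suc q))) (ones-run p q _) ⟩
  wordAtℕ (ones (p + suc (suc q)) ++ false ∷ B) (p + suc (suc q))
    ≡⟨ wordAtℕ-replicate (p + suc (suc q)) true (false ∷ B) ⟩
  0 ∎
  where open ≡-Reasoning

postMove-run-end : ∀ q B n →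
  wordAtℕ (ones q ++ true ∷ B) n ≡ (if n ≡ᵇ q then 1 else wordAtℕ (ones q ++ false ∷ B) n)
postMove-run-end zero    B zero    = refl
postMove-run-end zero    B (suc n) = refl
postMove-run-end (suc q) B zero    = refl
postMove-run-end (suc q) B (suc n) = postMove-run-end q B n

postMove-run : ∀ p q B n →
  wordAtℕ (ones p ++ false ∷ false ∷ ones q ++ true ∷ B) n ≡
  (if (n ≡ᵇ p) ∨ (n ≡ᵇ p + 1) then wordAtℕ (ones p ++ true ∷ true ∷ ones q ++ false ∷ B) n ∸ 1
   else if n ≡ᵇ p + suc (suc q) then 1 else wordAtℕ (ones p ++ true ∷ true ∷ ones q ++ false ∷ B) n)
postMove-run zero    q B zero          = refl
postMove-run zero    q B (suc zero)    = refl
postMove-run zero    q B (suc (suc n)) = postMove-run-end q B n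
postMove-run (suc p) q B zero          = refl
postMove-run (suc p) q B (suc n)       = postMove-run p q B n

postMove-pointwise : ∀ A p q B n →
  wordAtℕ (postMove A p q B) n ≡
  moveResult (wordAt (preMove A p q B))
    (+ (length A + suc p)) (+ length A) (+ (length A + suc (p + suc (suc q)))) (+ n)
postMove-pointwise []      p q B zero    = refl
postMove-pointwise []      p q B (suc n) = postMove-run p q B n
postMove-pointwise (_ ∷ A) p q B zero    = refl
postMove-pointwise (_ ∷ A) p q B (suc n) = postMove-pointwise A p q B n

move-step : ∀ {w w'} → w ⟶ w' → Step (wordAt w) (wordAt w')
move-step (move A p q B) =
  + i , + a , + b , occupied a<i i<b , occupied a<i+1 i+1<b ,
  (ℤ.+<+ a<i , wordAtℕ-at-length A false _ ,
   λ { (+ n) (ℤ.+<+ a<n) (ℤ.+<+ n<i) → occupied a<n (ℕP.<-trans n<i i<b) }) ,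
  (ℤ.+<+ i+1<b , preMove-right-end A p q B ,
   λ { (+ n) (ℤ.+<+ i+1<n) (ℤ.+<+ n<b) → occupied (ℕP.<-trans a<i+1 i+1<n) n<b }) ,
  λ { (+ n) → postMove-pointwise A p q B n ; -[1+ n ] → refl }
  where
  a = length A
  i = length A + suc p
  b = length A + suc (p + suc (suc q))
  occupied : ∀ {n} → a < n → n < b → 1 ≤ wordAtℕ (preMove A p q B) n
  occupied a<n n<b = ℕP.≤-reflexive (sym (preMove-run A p q B a<n n<b))
  a<i : a < i
  a<i = ℕP.m<m+n a (s≤s z≤n)
  i<i+1 : i < i + 1
  i<i+1 = ℕP.m<m+n i (s≤s z≤n)
  a<i+1 : a < i + 1
  a<i+1 = ℕP.<-trans a<i i<i+1
  i+1<b : i + 1 < b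
  i+1<b = subst (_< b) (sym i+1≡) (ℕP.+-monoʳ-< a (s≤s ss[p]≤p+ss[q]))
    where
    i+1≡ : i + 1 ≡ a + suc (suc p)
    i+1≡ = trans (ℕP.+-assoc a (suc p) 1) (cong (λ x → a + suc x) (ℕP.+-comm p 1))
    ss[p]≤p+ss[q] : suc (suc p) ≤ p + suc (suc q)
    ss[p]≤p+ss[q] = subst (_≤ p + suc (suc q)) (ℕP.+-comm p 2) (ℕP.+-monoʳ-≤ p (s≤s (s≤s z≤n)))
  i<b : i < b
  i<b = ℕP.<-trans i<i+1 i+1<b

⟶*-reachable : ∀ {w w'} → w ⟶* w' → Reachable (wordAt w) (wordAt w')
⟶*-reachable = gmap wordAt move-step

translate : ℤ → State → State
translate m s x = s (x ℤ.- m)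

i+j-j≡i : ∀ i j → (i ℤ.+ j) ℤ.- j ≡ i
i+j-j≡i = ℤ-Solver.solve-∀

i-j+j≡i : ∀ i j → (i ℤ.- j) ℤ.+ j ≡ i
i-j+j≡i = ℤ-Solver.solve-∀

i+j+1≡i+1+j : ∀ i j → (i ℤ.+ j) ℤ.+ + 1 ≡ (i ℤ.+ + 1) ℤ.+ j
i+j+1≡i+1+j = ℤ-Solver.solve-∀

i-j-k≡i-[j+k] : ∀ i j k → (i ℤ.- j) ℤ.- k ≡ i ℤ.- (j ℤ.+ k)
i-j-k≡i-[j+k] = ℤ-Solver.solve-∀

i+1-j≡i-j+1 : ∀ i j → (i ℤ.+ + 1) ℤ.- j ≡ (i ℤ.- j) ℤ.+ + 1
i+1-j≡i-j+1 = ℤ-Solver.solve-∀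

==-translate : ∀ x y m → (x == (y ℤ.+ m)) ≡ ((x ℤ.- m) == y)
==-translate x y m =
  does-⇔ (mk⇔ (λ { refl → i+j-j≡i y m }) (λ { refl → sym (i-j+j≡i x m) }))
         (x ℤ.≟ y ℤ.+ m) (x ℤ.- m ℤ.≟ y)

moveResult-translate : ∀ s m i a b x →
  moveResult (translate m s) (i ℤ.+ m) (a ℤ.+ m) (b ℤ.+ m) x ≡ moveResult s i a b (x ℤ.- m)
moveResult-translate s m i a b x
  rewrite i+j+1≡i+1+j i m | ==-translate x i m | ==-translate x (i ℤ.+ + 1) m
        | ==-translate x a m | ==-translate x b m = refl

Step-translate : ∀ m {s t} → Step s t → Step (translate m s) (translate m t)
Step-translate m {s} (i , a , b , occ-i , occ-i+1 , (a<i , empty-a , run-a) , (i+1<b , empty-b , run-b) , t≗) =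
  i ℤ.+ m , a ℤ.+ m , b ℤ.+ m ,
  back {1 ≤_} i occ-i ,
  subst (λ y → 1 ≤ translate m s y) (sym (i+j+1≡i+1+j i m)) (back {1 ≤_} (i ℤ.+ + 1) occ-i+1) ,
  (ℤP.+-monoˡ-< m a<i , back {_≡ 0} a empty-a ,
   λ j a+m<j j<i+m → run-a (j ℤ.- m) (lower a a+m<j) (upper i j<i+m)) ,
  (subst (ℤ._< b ℤ.+ m) (sym (i+j+1≡i+1+j i m)) (ℤP.+-monoˡ-< m i+1<b) , back {_≡ 0} b empty-b ,
   λ j i+m+1<j j<b+m →
     run-b (j ℤ.- m) (lower (i ℤ.+ + 1) (subst (ℤ._< j) (i+j+1≡i+1+j i m) i+m+1<j)) (upper b j<b+m)) ,
  λ x → trans (t≗ (x ℤ.- m)) (sym (moveResult-translate s m i a b x))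
  where
  back : ∀ {P : ℕ → Set} y → P (s y) → P (translate m s (y ℤ.+ m))
  back {P} y = subst (P ∘ s) (sym (i+j-j≡i y m))
  lower : ∀ y {j} → y ℤ.+ m ℤ.< j → y ℤ.< j ℤ.- m
  lower y y+m<j = subst (ℤ._< _) (i+j-j≡i y m) (ℤP.+-monoˡ-< (ℤ.- m) y+m<j)
  upper : ∀ y {j} → j ℤ.< y ℤ.+ m → j ℤ.- m ℤ.< y
  upper y j<y+m = subst (_ ℤ.<_) (i+j-j≡i y m) (ℤP.+-monoˡ-< (ℤ.- m) j<y+m)

Reachable-translate : ∀ m {s t} → Reachable s t → Reachable (translate m s) (translate m t)
Reachable-translate m = gmap (translate m) (Step-translate m)

-- moveResult s i a b x looks at s only at x.
moveResult-cong : ∀ {s s'} → s ≗ s' → ∀ i a b x → moveResult s i a b x ≡ moveResult s' i a b x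
moveResult-cong s≗s' i a b x = cong (λ v → moveResult (λ _ → v) i a b x) (s≗s' x)

Step-respˡ : ∀ {s s' t} → s ≗ s' → Step s t → Step s' t
Step-respˡ {s} {s'} s≗s'
  (i , a , b , occ-i , occ-i+1 , (a<i , empty-a , run-a) , (i+1<b , empty-b , run-b) , t≗) =
  i , a , b , occ occ-i , occ occ-i+1 ,
  (a<i , trans (sym (s≗s' a)) empty-a , λ j a<j j<i → occ (run-a j a<j j<i)) ,
  (i+1<b , trans (sym (s≗s' b)) empty-b , λ j i+1<j j<b → occ (run-b j i+1<j j<b)) ,
  λ x → trans (t≗ x) (moveResult-cong s≗s' i a b x)
  where
  occ : ∀ {x} → Occupied s x → Occupied s' x
  occ {x} = subst (1 ≤_) (s≗s' x)

Reachable-respˡ : ∀ {s s' t} → s ≗ s' → Reachable s t → ∃ λ t' → Reachable s' t' × t ≗ t'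
Reachable-respˡ {s' = s'} s≗s' ε            = s' , ε , s≗s'
Reachable-respˡ {t = t}   s≗s' (step ◅ steps) = t , Step-respˡ s≗s' step ◅ steps , λ _ → refl

Final-resp : ∀ {s t} → s ≗ t → Final s → Final t
Final-resp s≗t final (i , occ-i , occ-i+1) =
  final (i , subst (1 ≤_) (sym (s≗t i)) occ-i , subst (1 ≤_) (sym (s≗t _)) occ-i+1)

wordAt-false-∷ : ∀ W z → wordAt (false ∷ W) (z ℤ.+ + 1) ≡ wordAt W z
wordAt-false-∷ W (+ n)          = cong (wordAtℕ (false ∷ W)) (ℕP.+-comm n 1)
wordAt-false-∷ W -[1+ zero ]    = refl
wordAt-false-∷ W -[1+ suc n ]   = refl

wordAt-zeros-++ : ∀ L W z → wordAt (zeros L ++ W) (z ℤ.+ + L) ≡ wordAt W z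
wordAt-zeros-++ zero    W z = cong (wordAt W) (ℤP.+-identityʳ z)
wordAt-zeros-++ (suc L) W z = begin
  wordAt (zeros (suc L) ++ W) (z ℤ.+ + suc L)
    ≡⟨ cong (λ k → wordAt (zeros (suc L) ++ W) (z ℤ.+ + k)) (ℕP.+-comm 1 L) ⟩
  wordAt (zeros (suc L) ++ W) (z ℤ.+ (+ L ℤ.+ + 1))
    ≡⟨ cong (wordAt (zeros (suc L) ++ W)) (sym (ℤP.+-assoc z (+ L) (+ 1))) ⟩
  wordAt (zeros (suc L) ++ W) ((z ℤ.+ + L) ℤ.+ + 1)
    ≡⟨ wordAt-false-∷ (zeros L ++ W) (z ℤ.+ + L) ⟩
  wordAt (zeros L ++ W) (z ℤ.+ + L)
    ≡⟨ wordAt-zeros-++ L W z ⟩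
  wordAt W z ∎
  where open ≡-Reasoning

wordAtℕ-++-zeros : ∀ W R n → wordAtℕ (W ++ zeros R) n ≡ wordAtℕ W n
wordAtℕ-++-zeros []      zero    n       = refl
wordAtℕ-++-zeros []      (suc R) zero    = refl
wordAtℕ-++-zeros []      (suc R) (suc n) = wordAtℕ-++-zeros [] R n
wordAtℕ-++-zeros (_ ∷ W) R       zero    = refl
wordAtℕ-++-zeros (_ ∷ W) R       (suc n) = wordAtℕ-++-zeros W R n

wordAt-++-zeros : ∀ W R z → wordAt (W ++ zeros R) z ≡ wordAt W z
wordAt-++-zeros W R (+ n)    = wordAtℕ-++-zeros W R n
wordAt-++-zeros W R -[1+ n ] = refl

translate-padded : ∀ m L W R →
  translate m (wordAt (zeros L ++ W ++ zeros R)) ≗ translate (m ℤ.+ + L) (wordAt W)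
translate-padded m L W R x = begin
  wordAt (zeros L ++ W ++ zeros R) (x ℤ.- m)
    ≡⟨ cong (wordAt (zeros L ++ W ++ zeros R)) (sym (i-j+j≡i (x ℤ.- m) (+ L))) ⟩
  wordAt (zeros L ++ W ++ zeros R) ((x ℤ.- m ℤ.- + L) ℤ.+ + L)
    ≡⟨ wordAt-zeros-++ L (W ++ zeros R) (x ℤ.- m ℤ.- + L) ⟩
  wordAt (W ++ zeros R) (x ℤ.- m ℤ.- + L)
    ≡⟨ wordAt-++-zeros W R (x ℤ.- m ℤ.- + L) ⟩
  wordAt W (x ℤ.- m ℤ.- + L)
    ≡⟨ cong (wordAt W) (i-j-k≡i-[j+k] x m (+ L)) ⟩
  wordAt W (x ℤ.- (m ℤ.+ + L)) ∎
  where open ≡-Reasoning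

noAdjacentOnes-wordAtℕ : ∀ w n → noAdjacentOnes w ≡ true →
                         1 ≤ wordAtℕ w n → 1 ≤ wordAtℕ w (suc n) → ⊥
noAdjacentOnes-wordAtℕ (false ∷ w)        (suc n) sparse occ occ′ =
  noAdjacentOnes-wordAtℕ w n sparse occ occ′
noAdjacentOnes-wordAtℕ (true ∷ false ∷ w) (suc n) sparse occ occ′ =
  noAdjacentOnes-wordAtℕ (false ∷ w) n sparse occ occ′
noAdjacentOnes-wordAtℕ (true ∷ [])        zero    sparse occ ()
noAdjacentOnes-wordAtℕ (true ∷ false ∷ w) zero    sparse occ ()
noAdjacentOnes-wordAtℕ (true ∷ true ∷ w)  n       ()     occ occ′

noAdjacentOnes-final : ∀ v m → noAdjacentOnes v ≡ true → Final (translate m (wordAt v))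
noAdjacentOnes-final v m sparse (i , occ-i , occ-i+1) =
  adjacent (i ℤ.- m) occ-i (subst (λ z → 1 ≤ wordAt v z) (i+1-j≡i-j+1 i m) occ-i+1)
  where
  adjacent : ∀ z → 1 ≤ wordAt v z → 1 ≤ wordAt v (z ℤ.+ + 1) → ⊥
  adjacent (+ n)    occ occ′ =
    noAdjacentOnes-wordAtℕ v n sparse occ (subst (λ k → 1 ≤ wordAtℕ v k) (ℕP.+-comm n 1) occ′)
  adjacent -[1+ n ] ()  occ′

record Route (w v : Word) : Set where
  constructor route
  field
    {padˡ padʳ padˡ′ padʳ′} : ℕ
    path : zeros padˡ ++ w ++ zeros padʳ ⟶* zeros padˡ′ ++ v ++ zeros padʳ′

realise : ∀ {S w v} → HasShadow S w → Route w v → ProperWord v → noAdjacentOnes v ≡ true →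
          ∃ λ T → Reachable S T × Final T × HasShadow T v
realise {S} {w} {v} (_ , m , S≗w) (route {L} {R} {L′} {R′} path) proper sparse =
  T , S↝T , Final-resp (λ x → sym (T≗v x)) (noAdjacentOnes-final v m′ sparse) , proper , m′ , T≗v
  where
  m₀ = m ℤ.- + L
  m′ = m₀ ℤ.+ + L′
  start≗S : translate m₀ (wordAt (zeros L ++ w ++ zeros R)) ≗ S
  start≗S x = trans (translate-padded m₀ L w R x)
                    (trans (cong (λ k → wordAt w (x ℤ.- k)) (i-j+j≡i m (+ L))) (sym (S≗w x)))
  reached = Reachable-respˡ start≗S (Reachable-translate m₀ (⟶*-reachable path))
  T = proj₁ reached
  S↝T = proj₁ (proj₂ reached)
  T≗v : T ≗ translate m′ (wordAt v)
  T≗v x = trans (sym (proj₂ (proj₂ reached) x)) (translate-padded m₀ L′ v R′ x)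

prefix-⟶ : ∀ P {w w'} → w ⟶ w' → P ++ w ⟶ P ++ w'
prefix-⟶ P (move A p q B) = subst₂ _⟶_ (++-assoc P A _) (++-assoc P A _) (move (P ++ A) p q B)

prefix : ∀ P {w w'} → w ⟶* w' → P ++ w ⟶* P ++ w'
prefix P = gmap (P ++_) (prefix-⟶ P)

spaced-⟶ : ∀ a {w w'} → w ⟶ w' → spaced a w ⟶ spaced a w'
spaced-⟶ zero    step = step
spaced-⟶ (suc a) step = spaced-⟶ a (prefix-⟶ (true ∷ false ∷ []) step)

spaced-⟶* : ∀ a {w w'} → w ⟶* w' → spaced a w ⟶* spaced a w'
spaced-⟶* a = gmap (spaced a) (spaced-⟶ a)

unwind : ∀ a X → zeros a ++ ones (suc a) ++ false ∷ false ∷ X ⟶* true ∷ false ∷ false ∷ spaced a X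
unwind zero    X = ε
unwind (suc a) X = begin
  zeros (suc a) ++ ones (suc (suc a)) ++ false ∷ false ∷ X
    ≡⟨ sym (replicate-∷ a false _) ⟩
  zeros a ++ false ∷ true ∷ true ∷ ones a ++ false ∷ false ∷ X
    ≡⟨ cong (λ w → zeros a ++ false ∷ w) (sym (ones-++-11 a _)) ⟩
  zeros a ++ preMove [] a 0 (false ∷ X)
    ⟶⟨ prefix-⟶ (zeros a) (move [] a 0 (false ∷ X)) ⟩
  zeros a ++ ones (suc a) ++ false ∷ false ∷ true ∷ false ∷ X
    ⟶*⟨ unwind a (true ∷ false ∷ X) ⟩
  true ∷ false ∷ false ∷ spaced (suc a) X ∎
  where open StarReasoning _⟶_

bubble : ∀ b W →
  spaced b (true ∷ true ∷ false ∷ false ∷ W) ⟶* true ∷ true ∷ false ∷ false ∷ spaced b W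
bubble zero    W = ε
bubble (suc b) W = spaced-⟶ b (move (true ∷ []) 0 0 (false ∷ W)) ◅ bubble b (true ∷ false ∷ W)

shed : ∀ a b q Y →
  spaced a (true ∷ false ∷ false ∷ spaced b (true ∷ true ∷ ones q ++ false ∷ Y)) ⟶*
  spaced (suc a) (true ∷ false ∷ false ∷ spaced b (ones q ++ true ∷ Y))
shed a zero    q Y = spaced-⟶ a (move (true ∷ false ∷ []) 0 q Y) ◅ ε
shed a (suc b) q Y = begin
  spaced a (true ∷ false ∷ false ∷ spaced b (preMove (true ∷ []) 0 q Y))
    ⟶⟨ spaced-⟶ a (prefix-⟶ (true ∷ false ∷ false ∷ []) (spaced-⟶ b (move (true ∷ []) 0 q Y))) ⟩
  spaced a (true ∷ false ∷ false ∷ spaced b (true ∷ true ∷ false ∷ false ∷ ones q ++ true ∷ Y))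
    ⟶*⟨ spaced-⟶* a (prefix (true ∷ false ∷ false ∷ []) (bubble b (ones q ++ true ∷ Y))) ⟩
  spaced a (preMove (true ∷ false ∷ []) 0 0 (false ∷ spaced b (ones q ++ true ∷ Y)))
    ⟶⟨ spaced-⟶ a (move (true ∷ false ∷ []) 0 0 _) ⟩
  spaced a (true ∷ false ∷ true ∷ false ∷ false ∷ true ∷ false ∷ spaced b (ones q ++ true ∷ Y))
    ≡⟨ cong (λ w → spaced a (true ∷ false ∷ true ∷ false ∷ false ∷ w)) (sym (spaced-∷ b _)) ⟩
  spaced (suc a) (true ∷ false ∷ false ∷ spaced (suc b) (ones q ++ true ∷ Y)) ∎
  where open StarReasoning _⟶_

shedAll : ∀ m a b →
  spaced a (true ∷ false ∷ false ∷ spaced b (ones m ++ true ∷ zeros m)) ⟶* doubleGap (m + a) b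
shedAll zero    a b = ε
shedAll (suc m) a b = begin
  spaced a (true ∷ false ∷ false ∷ spaced b (true ∷ ones m ++ true ∷ false ∷ zeros m))
    ≡⟨ cong (λ w → spaced a (true ∷ false ∷ false ∷ spaced b (true ∷ w))) (replicate-∷ m true _) ⟩
  spaced a (true ∷ false ∷ false ∷ spaced b (true ∷ true ∷ ones m ++ false ∷ zeros m))
    ⟶*⟨ shed a b m (zeros m) ⟩
  spaced (suc a) (true ∷ false ∷ false ∷ spaced b (ones m ++ true ∷ zeros m))
    ⟶*⟨ shedAll m (suc a) b ⟩
  doubleGap (m + suc a) b
    ≡⟨ cong (λ k → doubleGap k b) (ℕP.+-suc m a) ⟩
  doubleGap (suc m + a) b ∎
  where open StarReasoning _⟶_

settle : ∀ b m →
  zeros b ++ ones (suc b) ++ false ∷ false ∷ ones m ++ true ∷ zeros m ⟶* doubleGap (m + 0) b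
settle b m = unwind b _ ◅◅ shedAll m 0 b

clusteron-route : ∀ {N k} → 1 ≤ k → k < N → Route (ones N) (F N k)
clusteron-route {k = suc m} _ k<N with b , refl ← ℕP.m≤n⇒∃[o]m+o≡n k<N =
  route {padˡ = suc b} {padʳ = suc m} {padˡ′ = 0} {padʳ′ = 0} (begin
    zeros (suc b) ++ ones (suc (suc m) + b) ++ zeros (suc m)
      ≡⟨ sym (replicate-∷ b false _) ⟩
    zeros b ++ false ∷ ones (suc (suc m) + b) ++ zeros (suc m)
      ≡⟨ cong (λ w → zeros b ++ false ∷ w) (ones-split b m _) ⟩
    zeros b ++ preMove [] b m (zeros m)
      ⟶⟨ prefix-⟶ (zeros b) (move [] b m (zeros m)) ⟩
    zeros b ++ ones (suc b) ++ false ∷ false ∷ ones m ++ true ∷ zeros m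
      ⟶*⟨ settle b m ⟩
    doubleGap (m + 0) b
      ≡⟨ doubleGap≡F (m + 0) b (N≡ m b) (cong suc (sym (ℕP.+-identityʳ m))) ⟩
    F (suc (suc m) + b) (suc m) ++ [] ∎)
  where
  open StarReasoning _⟶_
  N≡ : ∀ m b → suc (suc m) + b ≡ suc ((m + 0) + suc b)
  N≡ = ℕ-Solver.solve-∀

nearClusteron : ℕ → ℕ → Word
nearClusteron p q = ones p ++ false ∷ ones q

nearClusteron-route-< : ∀ {p q y} → suc y < q → Route (nearClusteron p q) (F (p + q) (suc y))
nearClusteron-route-< {p} {y = y} k<q with j , refl ← ℕP.m≤n⇒∃[o]m+o≡n k<q =
  route {padˡ = suc (p + j)} {padʳ = suc y} {padˡ′ = 1} {padʳ′ = 0} (begin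
    zeros (suc (p + j)) ++ nearClusteron p (suc (suc y) + j) ++ zeros (suc y)
      ≡⟨ cong (zeros (suc (p + j)) ++_)
              (trans (++-assoc (ones p) _ _) (cong (λ w → ones p ++ false ∷ w) (ones-split j y _))) ⟩
    zeros (suc (p + j)) ++ preMove (ones p) j y (zeros y)
      ⟶⟨ prefix-⟶ (zeros (suc (p + j))) (move (ones p) j y (zeros y)) ⟩
    false ∷ zeros (p + j) ++ ones p ++ true ∷ ones j ++ false ∷ false ∷ ones y ++ true ∷ zeros y
      ≡⟨ cong (λ w → false ∷ zeros (p + j) ++ w) (ones-merge p j _) ⟩
    false ∷ zeros (p + j) ++ ones (suc (p + j)) ++ false ∷ false ∷ ones y ++ true ∷ zeros y
      ⟶*⟨ prefix (false ∷ []) (settle (p + j) y) ⟩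
    false ∷ doubleGap (y + 0) (p + j)
      ≡⟨ cong (false ∷_) (doubleGap≡F (y + 0) (p + j) (N≡ p j y) (cong suc (sym (ℕP.+-identityʳ y)))) ⟩
    false ∷ F (p + (suc (suc y) + j)) (suc y) ++ [] ∎)
  where
  open StarReasoning _⟶_
  N≡ : ∀ p j y → p + (suc (suc y) + j) ≡ suc ((y + 0) + suc (p + j))
  N≡ = ℕ-Solver.solve-∀

nearClusteron-route-> : ∀ {p q y} → suc y < p → Route (nearClusteron p q) (F (p + q) (suc q + y))
nearClusteron-route-> {q = q} {y} y+1<p with b , refl ← ℕP.m≤n⇒∃[o]m+o≡n y+1<p =
  route {padˡ = suc b} {padʳ = y + q} {padˡ′ = 0} {padʳ′ = 0} (begin
    zeros (suc b) ++ nearClusteron (suc (suc y) + b) q ++ zeros (y + q)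
      ≡⟨ sym (replicate-∷ b false _) ⟩
    zeros b ++ false ∷ nearClusteron (suc (suc y) + b) q ++ zeros (y + q)
      ≡⟨ cong (λ w → zeros b ++ false ∷ w)
              (trans (++-assoc (ones (suc (suc y) + b)) _ _) (ones-split b y _)) ⟩
    zeros b ++ preMove [] b y (ones q ++ zeros (y + q))
      ⟶⟨ prefix-⟶ (zeros b) (move [] b y _) ⟩
    zeros b ++ ones (suc b) ++ false ∷ false ∷ ones y ++ true ∷ ones q ++ zeros (y + q)
      ≡⟨ cong (λ w → zeros b ++ ones (suc b) ++ false ∷ false ∷ w)
              (trans (ones-merge y q _) (sym (replicate-∷ (y + q) true _))) ⟩
    zeros b ++ ones (suc b) ++ false ∷ false ∷ ones (y + q) ++ true ∷ zeros (y + q)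
      ⟶*⟨ settle b (y + q) ⟩
    doubleGap ((y + q) + 0) b
      ≡⟨ doubleGap≡F ((y + q) + 0) b (N≡ b y q) (k≡ y q) ⟩
    F ((suc (suc y) + b) + q) (suc q + y) ++ [] ∎)
  where
  open StarReasoning _⟶_
  N≡ : ∀ b y q → (suc (suc y) + b) + q ≡ suc (((y + q) + 0) + suc b)
  N≡ = ℕ-Solver.solve-∀
  k≡ : ∀ y q → suc q + y ≡ suc ((y + q) + 0)
  k≡ = ℕ-Solver.solve-∀

nearClusteron-route-≡₁ : ∀ s → Route (nearClusteron 1 (3 + s)) (F (1 + (3 + s)) (3 + s))
nearClusteron-route-≡₁ s = route {padˡ = 1} {padʳ = 2 + s} {padˡ′ = 0} {padʳ′ = 0} (begin
    preMove (false ∷ true ∷ []) 1 s (zeros (suc s))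
      ⟶⟨ move (false ∷ true ∷ []) 1 s _ ⟩
    preMove [] 0 1 (false ∷ ones s ++ true ∷ zeros (suc s))
      ⟶⟨ move [] 0 1 _ ⟩
    true ∷ false ∷ false ∷ true ∷ true ∷ false ∷ ones s ++ true ∷ zeros (suc s)
      ⟶*⟨ shed 0 0 0 _ ⟩
    spaced 1 (true ∷ false ∷ false ∷ ones (suc s) ++ true ∷ zeros (suc s))
      ⟶*⟨ shedAll (suc s) 1 0 ⟩
    doubleGap (suc s + 1) 0
      ≡⟨ doubleGap≡F (suc s + 1) 0 (N≡ s) (k≡ s) ⟩
    F (1 + (3 + s)) (3 + s) ++ [] ∎)
  where
  open StarReasoning _⟶_
  N≡ : ∀ s → 1 + (3 + s) ≡ suc ((suc s + 1) + 1)
  N≡ = ℕ-Solver.solve-∀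
  k≡ : ∀ s → 3 + s ≡ suc (suc s + 1)
  k≡ = ℕ-Solver.solve-∀

nearClusteron-route-≡₂ : ∀ s → Route (nearClusteron 2 (3 + s)) (F (2 + (3 + s)) (3 + s))
nearClusteron-route-≡₂ s = route {padˡ = 2} {padʳ = 2 + s} {padˡ′ = 0} {padʳ′ = 0} (begin
    preMove (false ∷ false ∷ true ∷ true ∷ []) 1 s (zeros (suc s))
      ⟶⟨ move (false ∷ false ∷ true ∷ true ∷ []) 1 s _ ⟩
    false ∷ preMove [] 1 1 (false ∷ ones s ++ true ∷ zeros (suc s))
      ⟶⟨ prefix-⟶ (false ∷ []) (move [] 1 1 _) ⟩
    preMove [] 0 0 (false ∷ true ∷ true ∷ false ∷ ones s ++ true ∷ zeros (suc s))
      ⟶⟨ move [] 0 0 _ ⟩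
    true ∷ false ∷ false ∷ spaced 1 (true ∷ true ∷ false ∷ ones s ++ true ∷ zeros (suc s))
      ⟶*⟨ shed 0 1 0 _ ⟩
    spaced 1 (true ∷ false ∷ false ∷ spaced 1 (ones (suc s) ++ true ∷ zeros (suc s)))
      ⟶*⟨ shedAll (suc s) 1 1 ⟩
    doubleGap (suc s + 1) 1
      ≡⟨ doubleGap≡F (suc s + 1) 1 (N≡ s) (k≡ s) ⟩
    F (2 + (3 + s)) (3 + s) ++ [] ∎)
  where
  open StarReasoning _⟶_
  N≡ : ∀ s → 2 + (3 + s) ≡ suc ((suc s + 1) + 2)
  N≡ = ℕ-Solver.solve-∀
  k≡ : ∀ s → 3 + s ≡ suc (suc s + 1)
  k≡ = ℕ-Solver.solve-∀

nearClusteron-route-≡₃ : ∀ r s → Route (nearClusteron (3 + r) (suc s)) (F ((3 + r) + suc s) (suc s))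
nearClusteron-route-≡₃ r s = route {padˡ = 2 + r} {padʳ = suc s} {padˡ′ = 0} {padʳ′ = 0} (begin
    zeros (2 + r) ++ nearClusteron (3 + r) (suc s) ++ zeros (suc s)
      ≡⟨ trans (sym (replicate-∷ (suc r) false _))
               (cong (λ w → zeros (suc r) ++ false ∷ true ∷ true ∷ true ∷ w) (++-assoc (ones r) _ _)) ⟩
    zeros (suc r) ++ preMove [] 0 (suc r) (ones (suc s) ++ false ∷ zeros s)
      ⟶⟨ prefix-⟶ (zeros (suc r)) (move [] 0 (suc r) _) ⟩
    zeros (suc r) ++ preMove (true ∷ false ∷ []) (suc r) s (zeros s)
      ⟶⟨ prefix-⟶ (zeros (suc r)) (move (true ∷ false ∷ []) (suc r) s _) ⟩
    zeros (suc r) ++ true ∷ false ∷ true ∷ ones (suc r) ++ false ∷ false ∷ ones s ++ true ∷ zeros s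
      ≡⟨ cong (λ w → zeros (suc r) ++ true ∷ false ∷ w) (sym (ones-++-11 r _)) ⟩
    zeros (suc r) ++ preMove (true ∷ []) r 0 (false ∷ ones s ++ true ∷ zeros s)
      ⟶⟨ prefix-⟶ (zeros (suc r)) (move (true ∷ []) r 0 _) ⟩
    zeros (suc r) ++ ones (2 + r) ++ false ∷ false ∷ true ∷ false ∷ ones s ++ true ∷ zeros s
      ⟶*⟨ unwind (suc r) _ ⟩
    spaced 0 (true ∷ false ∷ false ∷ spaced (2 + r) (ones s ++ true ∷ zeros s))
      ⟶*⟨ shedAll s 0 (2 + r) ⟩
    doubleGap (s + 0) (2 + r)
      ≡⟨ doubleGap≡F (s + 0) (2 + r) (N≡ r s) (cong suc (sym (ℕP.+-identityʳ s))) ⟩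
    F ((3 + r) + suc s) (suc s) ++ [] ∎)
  where
  open StarReasoning _⟶_
  N≡ : ∀ r s → (3 + r) + suc s ≡ suc ((s + 0) + suc (2 + r))
  N≡ = ℕ-Solver.solve-∀

nearClusteron-route-≡ : ∀ {p q} → 1 ≤ p → 1 ≤ q → ¬ Excluded (nearClusteron p q) →
                        Route (nearClusteron p q) (F (p + q) q)
nearClusteron-route-≡ {1}                 {1}                 _ _ ok = ⊥-elim (ok (inj₂ (inj₂ (inj₂ refl))))
nearClusteron-route-≡ {1}                 {2}                 _ _ ok = ⊥-elim (ok (inj₂ (inj₁ refl)))
nearClusteron-route-≡ {1}                 {suc (suc (suc s))} _ _ _  = nearClusteron-route-≡₁ s
nearClusteron-route-≡ {2}                 {1}                 _ _ ok = ⊥-elim (ok (inj₂ (inj₂ (inj₁ refl))))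
nearClusteron-route-≡ {2}                 {2}                 _ _ ok = ⊥-elim (ok (inj₁ refl))
nearClusteron-route-≡ {2}                 {suc (suc (suc s))} _ _ _  = nearClusteron-route-≡₂ s
nearClusteron-route-≡ {suc (suc (suc r))} {suc s}             _ _ _  = nearClusteron-route-≡₃ r s

nearClusteron-route : ∀ {p q k} → 1 ≤ p → 1 ≤ q → ¬ Excluded (nearClusteron p q) →
                      1 ≤ k → k < p + q → Route (nearClusteron p q) (F (p + q) k)
nearClusteron-route {p} {q} {suc y} 1≤p 1≤q ok _ k<N with ℕP.<-cmp (suc y) q
... | tri< k<q _ _ = nearClusteron-route-< k<q
... | tri≈ _ refl _ = nearClusteron-route-≡ 1≤p 1≤q ok
... | tri> _ _ q<k with y′ , refl ← ℕP.m≤n⇒∃[o]m+o≡n q<k =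
  nearClusteron-route-> (ℕP.+-cancelʳ-< q (suc y′) p (subst (_< p + q) (cong suc (ℕP.+-comm q y′)) k<N))

flat-route : ∀ {N w k} → FlatClusteronWord N w ⊎ FlatNearClusteronWord N w → ¬ Excluded w →
             1 ≤ k → k < N → Route w (F N k)
flat-route (inj₁ (_ , refl))                        _  = clusteron-route
flat-route (inj₂ (p , q , 1≤p , 1≤q , refl , refl)) ok = nearClusteron-route 1≤p 1≤q ok

lemma5p7 : (N : ℕ) (S : State) (w : Word) →
    HasShadow S w →
    (FlatClusteronWord N w ⊎ FlatNearClusteronWord N w) →
    ¬ Excluded w →
    (k : ℕ) → 1 ≤ k → k < N →
    ∃ λ (T : State) → Reachable S T × Final T × HasShadow T (F N k)
lemma5p7 N S w shadow flat ok k 1≤k k<N with a , b , F≡ ← F-shape 1≤k k<N =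
  realise shadow (flat-route flat ok 1≤k k<N)
    (subst ProperWord (sym F≡) (doubleGap-proper a b))
    (subst (λ v → noAdjacentOnes v ≡ true) (sym F≡) (doubleGap-noAdjacentOnes a b))
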